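{- Let $\vec\nu$ be a path in a cyclic pre-proof and let $\vec m$ be a sequence of models that supports a finite left-hand (resp. right-hand) trace $\vec\tau_{1..n}$ along $\vec\nu$. Then $\mathrm{Ord}(\vec\tau_n,\vec m_n)+\mathrm{Prog}_{\vec\nu}(\vec\tau)\le\mathrm{Ord}(\vec\tau_1,\vec m_1)$ (resp. $\mathrm{Ord}(\vec\tau_n,\vec m_n)+\mathrm{Prog}_{\vec\nu}(\vec\tau)\ge\mathrm{Ord}(\vec\tau_1,\vec m_1)$), where $+$ is ordinal addition.
   Context: Abstract cyclic entailment systems. Fix sets $\mathcal{A}$ (antecedents) and $\mathcal{C}$ (consequents); a sequent is a pair $(A,C)\in\mathcal{A}\times\mathcal{C}$, written $A\vdash C$. A rule instance is a pair $(S,(S_1,\dots,S_n))$ of a sequent (conclusion) and a finite sequence of sequents (premises); it is axiomatic if $n=0$. Rules are sets of rule instances indexed by a set $\mathbb{R}$ ($\mathcal R_r$ the rule with index $r$); the system uses a fixed set $\vec r\subseteq\mathbb R$. A cyclic pre-proof is a finite directed graph whose nodes have ordered children, each node $\nu$ labelled by a sequent $\mathrm{Seq}(\nu)$ and an index $\mathrm{Rule}(\nu)\in\vec r$ with $(\mathrm{Seq}(\nu),(\mathrm{Seq}(\nu_1),\dots,\mathrm{Seq}(\nu_n)))\in\mathcal R_{\mathrm{Rule}(\nu)}$ for its children $\nu_1,\dots,\nu_n$. A path is a finite or infinite sequence of nodes each a child of the previous one. Semantics: a set $\mathcal M$ of models and relations $\models_{\mathcal A}\subseteq\mathcal M\times\mathcal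 A$, $\models_{\mathcal C}\subseteq\mathcal M\times\mathcal C$. Trace values: disjoint sets $\mathcal T_{\mathcal A},\mathcal T_{\mathcal C}$ and maps $\mathrm{TV}_{\mathcal A},\mathrm{TV}_{\mathcal C}$ giving a finite set of trace values to each antecedent (resp. consequent), extended to sequents and nodes via their antecedent/consequent. $\mathcal O$ is an initial segment of the ordinals. A trace pair function gives, for every non-axiomatic rule instance $(S,(S_1,\dots,S_n))$ and premise index $i$, partial functions $\delta_1:\mathrm{TV}_{\mathcal A}(S)\times\mathrm{TV}_{\mathcal A}(S_i)\rightharpoonup\mathcal O$ and $\delta_2:\mathrm{TV}_{\mathcal C}(S)\times\mathrm{TV}_{\mathcal C}(S_i)\rightharpoonup\mathcal O$; for a node $\nu$ with $i$-th child $\nu'$ these are written $\delta_1^{(\nu,\nu')},\delta_2^{(\nu,\nu')}$, and the elements of their domains are called left-hand (resp. right-hand) trace pairs for $(\nu,\nu')$. A left-hand (resp. right-hand) trace is a finite or infinite sequence of elements of $\mathcal T_{\mathcal A}$ (resp. $\mathcal T_{\mathcal C}$); it follows a path $\vec\nu$ if for every $i$ such that $\vec\tau_{i+1}$ exists, $\vec\nu_{i+1}$ exists and $(\vec\tau_i,\vec\tau_{i+1})$ is a left-hand (resp. right-hand) trace pair for $(\vec\nu_i,\vec\nu_{i+1})$. Ordinal trace function: a fixed partial function $\mathrm{Ord}:(\mathcal T_{\mathcal A}\cup\mathcal T_{\mathcal C})\times\mathcal M\rightharpoonup\mathcal O$, defined on every $(\tau,m)$ with $\tau\in\mathrm{TV}_{\mathcal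 A}(A)$ and $m\models_{\mathcal A}A$ for some antecedent $A$, and undefined on every $(\tau,m)$ with $\tau\in\mathrm{TV}_{\mathcal C}(C)$ and $m\not\models_{\mathcal C}C$ for some consequent $C$. Size of a trace: for a finite left-hand (resp. right-hand) trace $\vec\tau_{1..n}$ following a path $\vec\nu$, with $k=1$ (resp. $k=2$): $\mathrm{Prog}_{\vec\nu}(\vec\tau)=0$ if $n=1$, and $\mathrm{Prog}_{\vec\nu}(\vec\tau)=\delta_k^{(\vec\nu_{n-1},\vec\nu_n)}(\vec\tau_{n-1},\vec\tau_n)+\dots+\delta_k^{(\vec\nu_1,\vec\nu_2)}(\vec\tau_1,\vec\tau_2)$ (ordinal sum in this order) if $n>1$. Supports: let $\vec\nu$ be a path with $\mathrm{Seq}(\vec\nu_i)=A_i\vdash C_i$ and $\vec\tau_{1..n}$ a finite left-hand (resp. right-hand) trace. A sequence of models $\vec m_{1..k}$, $k\ge n$, supports $\vec\tau$ along $\vec\nu$ if $\vec\tau$ follows $\vec\nu$, for each $1\le i\le n$ we have $\vec m_i\models_{\mathcal A}A_i$ (resp. $\vec m_i\models_{\mathcal C}C_i$) and $\mathrm{Ord}(\vec\tau_i,\vec m_i)$ defined, and for each $1\le j<n$: $\mathrm{Ord}(\vec\tau_{j+1},\vec m_{j+1})+\delta_1^{(\vec\nu_j,\vec\nu_{j+1})}(\vec\tau_j,\vec\tau_{j+1})\le\mathrm{Ord}(\vec\tau_j,\vec m_j)$ (resp. with $\delta_2$ and $\ge$). -}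

module Defs where

open import Data.Nat using (ℕ; zero; suc; _<_; _≤_)
open import Data.Fin using (Fin; zero; suc; toℕ; inject₁; inject≤; fromℕ)
open import Data.Product using (Σ; _×_; _,_; proj₁; proj₂)
open import Data.List using (List)
open import Data.List.Membership.Propositional using (_∈_)
open import Data.Maybe using (Maybe; just; nothing; Is-just; to-witness)
open import Data.Maybe.Relation.Unary.All as MaybeAll using ()
open import Data.Unit using (⊤)
open import Data.Empty using (⊥)
open import Relation.Nullary using (¬_)
open import Relation.Binary.PropositionalEquality using (_≡_)

data Ordinal : Set₁ where
  ozero : Ordinal
  osuc  : Ordinal → Ordinal
  olim  : {I : Set} → (I → Ordinal) → Ordinal

infix 4 _≤ₒ_ _<ₒ_
mutual
  _≤ₒ_ : Ordinal → Ordinal → Set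
  ozero  ≤ₒ y = ⊤
  osuc x ≤ₒ y = x <ₒ y
  olim f ≤ₒ y = ∀ i → f i ≤ₒ y

  _<ₒ_ : Ordinal → Ordinal → Set
  x <ₒ ozero  = ⊥
  x <ₒ osuc y = x ≤ₒ y
  x <ₒ olim {I} f = Σ I (λ i → x <ₒ f i)

infixl 6 _+ₒ_
_+ₒ_ : Ordinal → Ordinal → Ordinal
x +ₒ ozero  = x
x +ₒ osuc y = osuc (x +ₒ y)
x +ₒ olim f = olim (λ i → x +ₒ f i)

record System : Set₁ where
  field
    Ant Con : Set
  Seq : Set
  Seq = Ant × Con
  field
    RIdx : Set
    Rule : RIdx → Seq → (n : ℕ) → (Fin n → Seq) → Set
    r⃗    : RIdx → Set
    Model : Set
    _⊨A_  : Model → Ant → Set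
    _⊨C_  : Model → Con → Set
    -- trace values (disjoint: separate types), finite sets given as lists
    TA TC : Set
    TVA : Ant → List TA
    TVC : Con → List TC
    InO      : Ordinal → Set
    InO-down : ∀ {x y} → x ≤ₒ y → InO y → InO x
    δ₁ : (S : Seq) (n : ℕ) (P : Fin n → Seq) → Fin n → TA → TA → Maybe Ordinal
    δ₂ : (S : Seq) (n : ℕ) (P : Fin n → Seq) → Fin n → TC → TC → Maybe Ordinal
    δ₁-dom : ∀ S n P i τ τ' → Is-just (δ₁ S n P i τ τ') →
             (τ ∈ TVA (proj₁ S)) × (τ' ∈ TVA (proj₁ (P i)))
    δ₂-dom : ∀ S n P i τ τ' → Is-just (δ₂ S n P i τ τ') →
             (τ ∈ TVC (proj₂ S)) × (τ' ∈ TVC (proj₂ (P i)))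
    δ₁-O : ∀ S n P i τ τ' → MaybeAll.All InO (δ₁ S n P i τ τ')
    δ₂-O : ∀ S n P i τ τ' → MaybeAll.All InO (δ₂ S n P i τ τ')
    -- ordinal trace function Ord (split along T_A ∪ T_C)
    OrdA : TA → Model → Maybe Ordinal
    OrdC : TC → Model → Maybe Ordinal
    OrdA-O : ∀ τ m → MaybeAll.All InO (OrdA τ m)
    OrdC-O : ∀ τ m → MaybeAll.All InO (OrdC τ m)
    OrdA-def   : ∀ A τ m → τ ∈ TVA A → m ⊨A A → Is-just (OrdA τ m)
    OrdC-undef : ∀ C τ m → τ ∈ TVC C → ¬ (m ⊨C C) → OrdC τ m ≡ nothing

record PreProof (𝒮 : System) : Set where
  open System 𝒮
  field
    size  : ℕ
    arity : Fin size → ℕ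
    child : (ν : Fin size) → Fin (arity ν) → Fin size
    seq   : Fin size → Seq
    rule  : Fin size → RIdx
    rule∈ : ∀ ν → r⃗ (rule ν)
    valid : ∀ ν → Rule (rule ν) (seq ν) (arity ν) (λ j → seq (child ν j))

Exists : Maybe ℕ → ℕ → Set
Exists nothing  i = ⊤
Exists (just k) i = i < k

-- A path (finite: len = just k nodes; infinite: len = nothing).
-- step i gives which child of node i is node (suc i).
record Path {𝒮 : System} (𝒫 : PreProof 𝒮) : Set where
  open PreProof 𝒫
  field
    len  : Maybe ℕ
    node : ℕ → Fin size
    step : (i : ℕ) → Exists len (suc i) → Fin (arity (node i))
    edge : ∀ i p → node (suc i) ≡ child (node i) (step i p)

data Side : Set where
  left right : Side

module _ {𝒮 : System} {𝒫 : PreProof 𝒮} where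
  open System 𝒮
  open PreProof 𝒫
  open Path

  TV : Side → Set
  TV left  = TA
  TV right = TC

  δat : (s : Side) (π : Path 𝒫) (i : ℕ) → Exists (len π) (suc i) →
        TV s → TV s → Maybe Ordinal
  δat left  π i p = δ₁ (seq (node π i)) (arity (node π i))
                        (λ j → seq (child (node π i) j)) (step π i p)
  δat right π i p = δ₂ (seq (node π i)) (arity (node π i))
                        (λ j → seq (child (node π i) j)) (step π i p)

  OrdS : (s : Side) → TV s → Model → Maybe Ordinal
  OrdS left  = OrdA
  OrdS right = OrdC

  Sat : Side → Model → Seq → Set
  Sat left  m S = m ⊨A proj₁ S
  Sat right m S = m ⊨C proj₂ S

  Cmp : Side → Ordinal → Ordinal → Set
  Cmp left  a b = a ≤ₒ b
  Cmp right a b = b ≤ₒ a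

  -- a trace τ₁..τ_{n+1} (0-indexed here) follows the path π
  Follows : (s : Side) (π : Path 𝒫) (n : ℕ) → (Fin (suc n) → TV s) → Set₁
  Follows s π n τ = (j : Fin n) →
    Σ (Exists (len π) (suc (toℕ j)))
      (λ p → Is-just (δat s π (toℕ j) p (τ (inject₁ j)) (τ (suc j))))

  δval : (s : Side) (π : Path 𝒫) (n : ℕ) (τ : Fin (suc n) → TV s) →
         Follows s π n τ → Fin n → Ordinal
  δval s π n τ F j = to-witness (proj₂ (F j))

  -- d (m-1) + … + d 0  (ordinal sum in this order), 0 for m = 0
  Σrev : (m : ℕ) → (Fin m → Ordinal) → Ordinal
  Σrev zero          d = ozero
  Σrev (suc zero)    d = d zero
  Σrev (suc (suc m)) d = Σrev (suc m) (λ j → d (suc j)) +ₒ d zero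

  Prog : (s : Side) (π : Path 𝒫) (n : ℕ) (τ : Fin (suc n) → TV s) →
         Follows s π n τ → Ordinal
  Prog s π n τ F = Σrev n (δval s π n τ F)

  record Supports (s : Side) (π : Path 𝒫) (n : ℕ) (τ : Fin (suc n) → TV s)
                  (k : ℕ) (m : Fin k → Model) (n<k : suc n ≤ k) : Set₁ where
    field
      follows : Follows s π n τ
      exists  : (i : Fin (suc n)) → Exists (len π) (toℕ i)
      sat     : (i : Fin (suc n)) → Sat s (m (inject≤ i n<k)) (seq (node π (toℕ i)))
      ordDef  : (i : Fin (suc n)) → Is-just (OrdS s (τ i) (m (inject≤ i n<k)))
    ordVal : Fin (suc n) → Ordinal
    ordVal i = to-witness (ordDef i)
    field
      decrease : (j : Fin n) →
        Cmp s (ordVal (suc j) +ₒ δval s π n τ follows j) (ordVal (inject₁ j))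

-- Each support condition says that Ord drops (for consequents: rises) by at
-- least the trace-pair value along one edge.  Chaining these inequalities from
-- the last edge back to the first, using monotonicity of ordinal addition in its
-- left argument and associativity, telescopes them into the single inequality
-- with the reversed ordinal sum Prog.
module Submission where

open import Defs
open import Data.Nat using (ℕ; suc; _≤_)
open import Data.Fin using (Fin; zero; suc; fromℕ; inject₁)
open import Data.Product using (_,_)
open import Data.Unit using (tt)

≤ₒ-olim : ∀ x {I : Set} (f : I → Ordinal) i → x ≤ₒ f i → x ≤ₒ olim f
≤ₒ-olim ozero    f i p = tt
≤ₒ-olim (osuc x) f i p = i , p
≤ₒ-olim (olim g) f i p = λ j → ≤ₒ-olim (g j) f i (p j)

≤ₒ-refl : ∀ x → x ≤ₒ x
≤ₒ-refl ozero    = tt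
≤ₒ-refl (osuc x) = ≤ₒ-refl x
≤ₒ-refl (olim f) = λ i → ≤ₒ-olim (f i) f i (≤ₒ-refl (f i))

mutual
  ≤ₒ-trans : ∀ x y z → x ≤ₒ y → y ≤ₒ z → x ≤ₒ z
  ≤ₒ-trans ozero    y z p q = tt
  ≤ₒ-trans (osuc x) y z p q = <ₒ-≤ₒ-trans x y z p q
  ≤ₒ-trans (olim f) y z p q = λ i → ≤ₒ-trans (f i) y z (p i) q

  <ₒ-≤ₒ-trans : ∀ x y z → x <ₒ y → y ≤ₒ z → x <ₒ z
  <ₒ-≤ₒ-trans x ozero    z ()      q
  <ₒ-≤ₒ-trans x (osuc y) z p       q = ≤ₒ-<ₒ-trans x y z p q
  <ₒ-≤ₒ-trans x (olim g) z (i , p) q = <ₒ-≤ₒ-trans x (g i) z p (q i)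

  ≤ₒ-<ₒ-trans : ∀ x y z → x ≤ₒ y → y <ₒ z → x <ₒ z
  ≤ₒ-<ₒ-trans x y ozero    p ()
  ≤ₒ-<ₒ-trans x y (osuc z) p q       = ≤ₒ-trans x y z p q
  ≤ₒ-<ₒ-trans x y (olim h) p (i , q) = i , ≤ₒ-<ₒ-trans x y (h i) p q

+ₒ-monoˡ-≤ₒ : ∀ a b c → a ≤ₒ b → a +ₒ c ≤ₒ b +ₒ c
+ₒ-monoˡ-≤ₒ a b ozero    p = p
+ₒ-monoˡ-≤ₒ a b (osuc c) p = +ₒ-monoˡ-≤ₒ a b c p
+ₒ-monoˡ-≤ₒ a b (olim f) p =
  λ i → ≤ₒ-olim (a +ₒ f i) (λ i → b +ₒ f i) i (+ₒ-monoˡ-≤ₒ a b (f i) p)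

+ₒ-assoc-≤ₒ : ∀ a b c → a +ₒ (b +ₒ c) ≤ₒ (a +ₒ b) +ₒ c
+ₒ-assoc-≤ₒ a b ozero    = ≤ₒ-refl (a +ₒ b)
+ₒ-assoc-≤ₒ a b (osuc c) = +ₒ-assoc-≤ₒ a b c
+ₒ-assoc-≤ₒ a b (olim f) =
  λ i → ≤ₒ-olim (a +ₒ (b +ₒ f i)) (λ i → (a +ₒ b) +ₒ f i) i (+ₒ-assoc-≤ₒ a b (f i))

+ₒ-assoc-≥ₒ : ∀ a b c → (a +ₒ b) +ₒ c ≤ₒ a +ₒ (b +ₒ c)
+ₒ-assoc-≥ₒ a b ozero    = ≤ₒ-refl (a +ₒ b)
+ₒ-assoc-≥ₒ a b (osuc c) = +ₒ-assoc-≥ₒ a b c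
+ₒ-assoc-≥ₒ a b (olim f) =
  λ i → ≤ₒ-olim ((a +ₒ b) +ₒ f i) (λ i → a +ₒ (b +ₒ f i)) i (+ₒ-assoc-≥ₒ a b (f i))

-- Cmp and Σrev are parametrised by a system and pre-proof they never inspect,
-- so these have to be supplied explicitly.
module _ {𝒮 : System} {𝒫 : PreProof 𝒮} where

  Cmp-refl : ∀ s a → Cmp {𝒮} {𝒫} s a a
  Cmp-refl left  a = ≤ₒ-refl a
  Cmp-refl right a = ≤ₒ-refl a

  Cmp-trans : ∀ s a b c → Cmp {𝒮} {𝒫} s a b → Cmp {𝒮} {𝒫} s b c → Cmp {𝒮} {𝒫} s a c
  Cmp-trans left  a b c p q = ≤ₒ-trans a b c p q
  Cmp-trans right a b c p q = ≤ₒ-trans c b a q p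

  Cmp-+ₒ-monoˡ : ∀ s a b c → Cmp {𝒮} {𝒫} s a b → Cmp {𝒮} {𝒫} s (a +ₒ c) (b +ₒ c)
  Cmp-+ₒ-monoˡ left  a b c p = +ₒ-monoˡ-≤ₒ a b c p
  Cmp-+ₒ-monoˡ right a b c p = +ₒ-monoˡ-≤ₒ b a c p

  Cmp-+ₒ-assoc : ∀ s a b c → Cmp {𝒮} {𝒫} s (a +ₒ (b +ₒ c)) ((a +ₒ b) +ₒ c)
  Cmp-+ₒ-assoc left  a b c = +ₒ-assoc-≤ₒ a b c
  Cmp-+ₒ-assoc right a b c = +ₒ-assoc-≥ₒ a b c

  Cmp-telescope : ∀ s n (o : Fin (suc n) → Ordinal) (d : Fin n → Ordinal) →
                  (∀ j → Cmp {𝒮} {𝒫} s (o (suc j) +ₒ d j) (o (inject₁ j))) →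
                  Cmp {𝒮} {𝒫} s (o (fromℕ n) +ₒ Σrev {𝒮} {𝒫} n d) (o zero)
  Cmp-telescope s 0             o d step = Cmp-refl s (o zero)
  Cmp-telescope s 1             o d step = step zero
  Cmp-telescope s (suc (suc n)) o d step =
    Cmp-trans s (last +ₒ (rest +ₒ first)) ((last +ₒ rest) +ₒ first) (o zero)
      (Cmp-+ₒ-assoc s last rest first)
      (Cmp-trans s ((last +ₒ rest) +ₒ first) (o (suc zero) +ₒ first) (o zero)
        (Cmp-+ₒ-monoˡ s (last +ₒ rest) (o (suc zero)) first
          (Cmp-telescope s (suc n) (λ j → o (suc j)) (λ j → d (suc j)) (λ j → step (suc j))))
        (step zero))
    where
      last  = o (fromℕ (suc (suc n)))
      rest  = Σrev {𝒮} {𝒫} (suc n) (λ j → d (suc j))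
      first = d zero

mainTheorem2 : (𝒮 : System) (𝒫 : PreProof 𝒮) (π : Path 𝒫) (s : Side)
               (n : ℕ) (τ : Fin (suc n) → TV {𝒮} {𝒫} s)
               (k : ℕ) (m : Fin k → System.Model 𝒮) (n<k : suc n ≤ k)
               (S : Supports s π n τ k m n<k) →
               Cmp {𝒮} {𝒫} s
                 (Supports.ordVal S (fromℕ n) +ₒ Prog s π n τ (Supports.follows S))
                 (Supports.ordVal S zero)
mainTheorem2 𝒮 𝒫 π s n τ k m n<k S =
  Cmp-telescope {𝒮} {𝒫} s n (Supports.ordVal S) _ (Supports.decrease S)
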